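{- Let $B_n^+=\{\pi\in B_n:\pi(n)>0\}$. Then for $n\ge 1$, \[\sum_{\pi\in B_n^+}t^{\operatorname{des}_B(\pi)}=\sum_{k=0}^{n-1}\binom{n}{k}B_k(t)(t-1)^{n-k-1},\] where $B_k(t)=\sum_{\pi\in B_k}t^{\operatorname{des}_B(\pi)}$ and $B_0(t)=1$.
   Context: $B_n$ denotes the group of signed permutations: bijections $\pi$ of $[-n,n]$ with $\pi(-i)=-\pi(i)$ (so $\pi(0)=0$), written $[\pi(1),\dots,\pi(n)]$. $\operatorname{Des}_B(\pi)=\{i\in\{0,\dots,n-1\}:\pi(i)>\pi(i+1)\}$ and $\operatorname{des}_B(\pi)=|\operatorname{Des}_B(\pi)|$. -}

module Defs where

open import Data.Nat using (ℕ; zero; suc)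
import Data.Nat as ℕ
open import Data.Integer using (ℤ; +_; -_; _<?_; ∣_∣; _+_; _*_; _-_; _^_; 0ℤ; 1ℤ)
open import Data.List using (List; []; _∷_; map; concatMap; filter; foldr; last; upTo; length)
open import Data.Maybe using (Maybe; just; nothing)
open import Data.Bool using (Bool; true; false; if_then_else_)
open import Relation.Nullary using (Dec; yes; no; does)
open import Relation.Unary using (Decidable)
open import Data.List.Relation.Unary.Unique.DecPropositional ℕ._≟_ using (Unique; unique?)

words : {A : Set} → ℕ → List A → List (List A)
words zero    L = [] ∷ []
words (suc k) L = concatMap (λ x → map (x ∷_) (words k L)) L

signedVals : ℕ → List ℤ
signedVals n = concatMap (λ i → (+ suc i) ∷ (- (+ suc i)) ∷ []) (upTo n)

-- a word [π(1),…,π(n)] with entries in [-n,n]∖{0} is a signed permutation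
-- iff the absolute values |π(1)|,…,|π(n)| are pairwise distinct
IsSignedPerm : List ℤ → Set
IsSignedPerm w = Unique (map ∣_∣ w)

isSignedPerm? : Decidable IsSignedPerm
isSignedPerm? w = unique? (map ∣_∣ w)

-- B_n, listed as window notations [π(1),…,π(n)] (each element exactly once)
Bn : ℕ → List (List ℤ)
Bn n = filter isSignedPerm? (words n (signedVals n))

-- π(n) > 0  (for the empty word: false; only used with n ≥ 1)
LastPos : List ℤ → Set
LastPos w with last w
... | just x  = 0ℤ Data.Integer.< x
... | nothing = Data.Empty.⊥
  where import Data.Empty

lastPos? : Decidable LastPos
lastPos? w with last w
... | just x  = 0ℤ <? x
... | nothing = no (λ ())

Bn⁺ : ℕ → List (List ℤ)
Bn⁺ n = filter lastPos? (Bn n)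

descents : List ℤ → ℕ
descents (x ∷ y ∷ r) = (if does (y <? x) then 1 else 0) ℕ.+ descents (y ∷ r)
descents _ = 0

desB : List ℤ → ℕ
desB w = descents (0ℤ ∷ w)

sumℤ : List ℤ → ℤ
sumℤ = foldr _+_ 0ℤ

desPoly : List (List ℤ) → ℤ → ℤ
desPoly S t = sumℤ (map (λ w → t ^ desB w) S)

Bpoly : ℕ → ℤ → ℤ
Bpoly k t = desPoly (Bn k) t

-- Refine by the last letter: for π ∈ B_{k+1} let a_k(c), resp. ā_k(c), be the descent generating
-- function of the π with π(k+1) = c+1, resp. -(c+1). Deleting the last letter and standardising the
-- rest (an order-preserving relabelling, which preserves descents and being a signed permutation)
-- gives B_{k+1} = Σ_c (a_k(c) + ā_k(c)), the left-hand side = Σ_c a_k(c), and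
-- a_{k+1}(i) = B_{k+1} + (t - 1) Σ_{c ≥ i} a_k(c), the extra factor coming from the descent before
-- the last letter. Hence a_k(i) = Σ_j C(k - i, j) (t - 1)^j B_{k-j} by induction, and summing over i
-- with the hockey-stick identity gives the formula.
module Submission where

open import Defs
open import Data.Bool using (Bool; true; false; if_then_else_; _∧_)
open import Data.Empty using (⊥-elim)
open import Data.Integer as ℤ using (ℤ; +_; -[1+_]; _+_; _*_; _-_; _^_; 0ℤ; 1ℤ; ∣_∣; _<?_; _◃_; -<-; -<+; +<+)
import Data.Integer.Properties as ℤ
open import Algebra.Properties.CommutativeSemigroup ℤ.+-commutativeSemigroup using (interchange)
open import Data.Integer.Tactic.RingSolver using (solve-∀)
open import Data.List using (List; []; _∷_; _++_; _∷ʳ_; map; concatMap; filter; upTo; last)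
open import Data.List.Properties using (upTo-∷ʳ; map-∘; map-++; map-id; map-applyUpTo; ++-assoc; filter-all; filter-accept; filter-reject)
open import Data.List.Relation.Unary.All as All using (All; []; _∷_; all?)
import Data.List.Relation.Unary.All.Properties as All
open import Data.List.Relation.Unary.AllPairs using (AllPairs; []; _∷_)
open import Data.List.Relation.Unary.Unique.Propositional using (Unique)
import Data.List.Relation.Unary.Unique.Propositional.Properties as Unique
open import Data.Maybe using (just)
open import Data.Nat as ℕ using (ℕ; zero; suc; _∸_; _≤_; _<_; _≤ᵇ_; _<ᵇ_; s≤s; z≤n)
import Data.Nat.Properties as ℕ
open import Data.Nat.Combinatorics using (_C_; nCk+nC[k+1]≡[n+1]C[k+1]; nCk≡nC[n∸k])
open import Data.Product using (_×_; _,_)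
open import Data.Sign using (Sign)
open import Function using (_⇔_; mk⇔; _∘_)
open import Level using (0ℓ)
open import Relation.Binary using (Rel; Trichotomous; Irreflexive; Asymmetric; Monotonic₁; tri<; tri≈; tri>)
open import Relation.Binary.PropositionalEquality
open import Relation.Nullary using (does; ¬?; _×-dec_; yes; no)
open import Relation.Nullary.Decidable using (does-⇔)
open import Relation.Unary using (Decidable)
open ≡-Reasoning

when : Bool → ℤ → ℤ
when b v = if b then v else 0ℤ

when-∧ : ∀ a b v → when (a ∧ b) v ≡ when b (when a v)
when-∧ true  true  v = refl
when-∧ true  false v = refl
when-∧ false true  v = refl
when-∧ false false v = refl

when-* : ∀ b q p → when b (q * p) ≡ q * when b p
when-* true  q p = refl
when-* false q p = sym (ℤ.*-zeroʳ q)

when-when : ∀ a b v → when a (when b v) ≡ when b 1ℤ * when a v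
when-when a     true  v = sym (ℤ.*-identityˡ (when a v))
when-when true  false v = refl
when-when false false v = refl

∑ : {A : Set} → List A → (A → ℤ) → ℤ
∑ L f = sumℤ (map f L)

∑-cong : {A : Set} (L : List A) {f g : A → ℤ} → (∀ x → f x ≡ g x) → ∑ L f ≡ ∑ L g
∑-cong []      f≗g = refl
∑-cong (x ∷ L) f≗g = cong₂ _+_ (f≗g x) (∑-cong L f≗g)

∑-++ : {A : Set} (L M : List A) (f : A → ℤ) → ∑ (L ++ M) f ≡ ∑ L f + ∑ M f
∑-++ []      M f = sym (ℤ.+-identityˡ (∑ M f))
∑-++ (x ∷ L) M f = trans (cong (_+_ (f x)) (∑-++ L M f)) (sym (ℤ.+-assoc (f x) _ _))

∑-map : {A B : Set} (L : List A) (h : A → B) (f : B → ℤ) → ∑ (map h L) f ≡ ∑ L (λ x → f (h x))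
∑-map []      h f = refl
∑-map (x ∷ L) h f = cong (_+_ (f (h x))) (∑-map L h f)

∑-concatMap : {A B : Set} (L : List A) (g : A → List B) (f : B → ℤ) →
              ∑ (concatMap g L) f ≡ ∑ L (λ x → ∑ (g x) f)
∑-concatMap []      g f = refl
∑-concatMap (x ∷ L) g f = trans (∑-++ (g x) (concatMap g L) f) (cong (_+_ (∑ (g x) f)) (∑-concatMap L g f))

∑-zero : {A : Set} (L : List A) → ∑ L (λ _ → 0ℤ) ≡ 0ℤ
∑-zero []      = refl
∑-zero (x ∷ L) = trans (ℤ.+-identityˡ _) (∑-zero L)

∑-+ : {A : Set} (L : List A) (f g : A → ℤ) → ∑ L (λ x → f x + g x) ≡ ∑ L f + ∑ L g
∑-+ []      f g = refl
∑-+ (x ∷ L) f g = trans (cong (_+_ (f x + g x)) (∑-+ L f g)) (interchange (f x) (g x) (∑ L f) (∑ L g))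

∑-* : {A : Set} (L : List A) (c : ℤ) (f : A → ℤ) → ∑ L (λ x → c * f x) ≡ c * ∑ L f
∑-* []      c f = sym (ℤ.*-zeroʳ c)
∑-* (x ∷ L) c f = trans (cong (_+_ (c * f x)) (∑-* L c f)) (sym (ℤ.*-distribˡ-+ c (f x) _))

∑-swap : {A B : Set} (L : List A) (M : List B) (f : A → B → ℤ) →
         ∑ L (λ x → ∑ M (f x)) ≡ ∑ M (λ y → ∑ L (λ x → f x y))
∑-swap []      M f = sym (∑-zero M)
∑-swap (x ∷ L) M f =
  trans (cong (_+_ (∑ M (f x))) (∑-swap L M f)) (sym (∑-+ M (f x) (λ y → ∑ L (λ x → f x y))))

∑-filter : {A : Set} {P : A → Set} (P? : Decidable P) (L : List A) (f : A → ℤ) →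
           ∑ (filter P? L) f ≡ ∑ L (λ x → when (does (P? x)) (f x))
∑-filter P? []      f = refl
∑-filter P? (x ∷ L) f with does (P? x)
... | true  = cong (_+_ (f x)) (∑-filter P? L f)
... | false = trans (∑-filter P? L f) (sym (ℤ.+-identityˡ _))

∑< : ℕ → (ℕ → ℤ) → ℤ
∑< zero    f = 0ℤ
∑< (suc n) f = ∑< n f + f n

∑-upTo : (n : ℕ) (f : ℕ → ℤ) → ∑ (upTo n) f ≡ ∑< n f
∑-upTo zero    f = refl
∑-upTo (suc n) f = begin
  ∑ (upTo (suc n)) f        ≡⟨ cong (λ L → ∑ L f) (sym (upTo-∷ʳ n)) ⟩
  ∑ (upTo n ∷ʳ n) f         ≡⟨ ∑-++ (upTo n) (n ∷ []) f ⟩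
  ∑ (upTo n) f + (f n + 0ℤ) ≡⟨ cong₂ _+_ (∑-upTo n f) (ℤ.+-identityʳ (f n)) ⟩
  ∑< n f + f n              ∎

∑<-cong : ∀ n {f g : ℕ → ℤ} → (∀ c → c ℕ.< n → f c ≡ g c) → ∑< n f ≡ ∑< n g
∑<-cong zero    f≗g = refl
∑<-cong (suc n) f≗g = cong₂ _+_ (∑<-cong n (λ c c<n → f≗g c (ℕ.m<n⇒m<1+n c<n))) (f≗g n ℕ.≤-refl)

∑<-zero : ∀ n → ∑< n (λ _ → 0ℤ) ≡ 0ℤ
∑<-zero zero    = refl
∑<-zero (suc n) = trans (ℤ.+-identityʳ _) (∑<-zero n)

∑<-+ : ∀ n (f g : ℕ → ℤ) → ∑< n (λ c → f c + g c) ≡ ∑< n f + ∑< n g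
∑<-+ zero    f g = refl
∑<-+ (suc n) f g = trans (cong (_+ (f n + g n)) (∑<-+ n f g)) (interchange (∑< n f) (∑< n g) (f n) (g n))

∑<-* : ∀ n (a : ℤ) (f : ℕ → ℤ) → ∑< n (λ c → a * f c) ≡ a * ∑< n f
∑<-* zero    a f = sym (ℤ.*-zeroʳ a)
∑<-* (suc n) a f = trans (cong (_+ a * f n) (∑<-* n a f)) (sym (ℤ.*-distribˡ-+ a (∑< n f) (f n)))

∑<-shift : ∀ n (f : ℕ → ℤ) → ∑< (suc n) f ≡ f 0 + ∑< n (λ c → f (suc c))
∑<-shift zero    f = trans (ℤ.+-identityˡ (f 0)) (sym (ℤ.+-identityʳ (f 0)))
∑<-shift (suc n) f = trans (cong (_+ f (suc n)) (∑<-shift n f)) (ℤ.+-assoc (f 0) _ _)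

∑<-reverse : ∀ n (f : ℕ → ℤ) → ∑< n f ≡ ∑< n (λ c → f (n ∸ suc c))
∑<-reverse zero    f = refl
∑<-reverse (suc n) f = begin
  ∑< n f + f n                         ≡⟨ cong (_+ f n) (∑<-reverse n f) ⟩
  ∑< n (λ c → f (n ∸ suc c)) + f n     ≡⟨ ℤ.+-comm _ (f n) ⟩
  f n + ∑< n (λ c → f (n ∸ suc c))     ≡⟨ sym (∑<-shift n (λ c → f (suc n ∸ suc c))) ⟩
  ∑< (suc n) (λ c → f (suc n ∸ suc c)) ∎

∑<-swap : ∀ n m (f : ℕ → ℕ → ℤ) → ∑< n (λ a → ∑< m (f a)) ≡ ∑< m (λ b → ∑< n (λ a → f a b))
∑<-swap zero    m f = sym (∑<-zero m)
∑<-swap (suc n) m f =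
  trans (cong (_+ ∑< m (f n)) (∑<-swap n m f)) (sym (∑<-+ m (λ b → ∑< n (λ a → f a b)) (f n)))

≤ᵇ-<ᵇ-suc : ∀ i c → (i ≤ᵇ c) ≡ (i <ᵇ suc c)
≤ᵇ-<ᵇ-suc zero    c = refl
≤ᵇ-<ᵇ-suc (suc i) c = refl

∑<-from : ∀ i n (F : ℕ → ℤ) → ∑< n (λ c → when (i ≤ᵇ c) (F (n ∸ suc c))) ≡ ∑< (n ∸ i) F
∑<-from zero    n       F = sym (∑<-reverse n F)
∑<-from (suc i) zero    F = refl
∑<-from (suc i) (suc n) F = begin
  ∑< (suc n) (λ c → when (suc i ≤ᵇ c) (F (suc n ∸ suc c)))
    ≡⟨ ∑<-shift n _ ⟩
  0ℤ + ∑< n (λ c → when (i <ᵇ suc c) (F (n ∸ suc c)))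
    ≡⟨ ℤ.+-identityˡ _ ⟩
  ∑< n (λ c → when (i <ᵇ suc c) (F (n ∸ suc c)))
    ≡⟨ ∑<-cong n (λ c _ → cong (λ b → when b (F (n ∸ suc c))) (≤ᵇ-<ᵇ-suc i c)) ⟨
  ∑< n (λ c → when (i ≤ᵇ c) (F (n ∸ suc c)))
    ≡⟨ ∑<-from i n F ⟩
  ∑< (n ∸ i) F
    ∎

hockeyStick : ∀ n j → ∑< n (λ q → + (q C j)) ≡ + (n C suc j)
hockeyStick zero    j = refl
hockeyStick (suc n) j = begin
  ∑< n (λ q → + (q C j)) + + (n C j) ≡⟨ cong (_+ + (n C j)) (hockeyStick n j) ⟩
  + (n C suc j) + + (n C j)          ≡⟨ ℤ.pos-+ (n C suc j) (n C j) ⟨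
  + (n C suc j ℕ.+ n C j)            ≡⟨ cong +_ (trans (ℕ.+-comm (n C suc j) (n C j)) (nCk+nC[k+1]≡[n+1]C[k+1] n j)) ⟩
  + (suc n C suc j)                  ∎

∑-words-suc : {A : Set} (k : ℕ) (L : List A) (F : List A → ℤ) →
              ∑ (words (suc k) L) F ≡ ∑ L (λ x → ∑ (words k L) (λ w → F (x ∷ w)))
∑-words-suc k L F = trans (∑-concatMap L (λ x → map (x ∷_) (words k L)) F)
                          (∑-cong L (λ x → ∑-map (words k L) (x ∷_) F))

∑-words-∷ʳ : {A : Set} (k : ℕ) (L : List A) (F : List A → ℤ) →
             ∑ (words (suc k) L) F ≡ ∑ L (λ y → ∑ (words k L) (λ w → F (w ∷ʳ y)))
∑-words-∷ʳ zero    L F = ∑-words-suc zero L F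
∑-words-∷ʳ (suc k) L F = begin
  ∑ (words (suc (suc k)) L) F
    ≡⟨ ∑-words-suc (suc k) L F ⟩
  ∑ L (λ x → ∑ (words (suc k) L) (λ w → F (x ∷ w)))
    ≡⟨ ∑-cong L (λ x → ∑-words-∷ʳ k L (λ w → F (x ∷ w))) ⟩
  ∑ L (λ x → ∑ L (λ y → ∑ (words k L) (λ w → F (x ∷ w ∷ʳ y))))
    ≡⟨ ∑-swap L L _ ⟩
  ∑ L (λ y → ∑ L (λ x → ∑ (words k L) (λ w → F (x ∷ w ∷ʳ y))))
    ≡⟨ ∑-cong L (λ y → sym (∑-words-suc k L (λ w → F (w ∷ʳ y)))) ⟩
  ∑ L (λ y → ∑ (words (suc k) L) (λ w → F (w ∷ʳ y)))
    ∎

∑-words-map : {A B : Set} (k : ℕ) (L : List A) (g : A → B) (F : List B → ℤ) →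
              ∑ (words k (map g L)) F ≡ ∑ (words k L) (λ w → F (map g w))
∑-words-map zero    L g F = refl
∑-words-map (suc k) L g F = begin
  ∑ (words (suc k) (map g L)) F
    ≡⟨ ∑-words-suc k (map g L) F ⟩
  ∑ (map g L) (λ x → ∑ (words k (map g L)) (λ w → F (x ∷ w)))
    ≡⟨ ∑-map L g _ ⟩
  ∑ L (λ x → ∑ (words k (map g L)) (λ w → F (g x ∷ w)))
    ≡⟨ ∑-cong L (λ x → ∑-words-map k L g (λ w → F (g x ∷ w))) ⟩
  ∑ L (λ x → ∑ (words k L) (λ w → F (g x ∷ map g w)))
    ≡⟨ sym (∑-words-suc k L _) ⟩
  ∑ (words (suc k) L) (λ w → F (map g w))
    ∎

∑-words-all : {A : Set} {P : A → Set} (P? : Decidable P) (k : ℕ) (L : List A) (F : List A → ℤ) →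
              ∑ (words k L) (λ w → when (does (all? P? w)) (F w)) ≡ ∑ (words k (filter P? L)) F
∑-words-all P? zero    L F = refl
∑-words-all P? (suc k) L F = begin
  ∑ (words (suc k) L) (λ w → when (does (all? P? w)) (F w))
    ≡⟨ ∑-words-suc k L _ ⟩
  ∑ L (λ x → ∑ (words k L) (λ w → when (does (P? x) ∧ does (all? P? w)) (F (x ∷ w))))
    ≡⟨ ∑-cong L first-letter ⟩
  ∑ L (λ x → when (does (P? x)) (∑ (words k (filter P? L)) (λ w → F (x ∷ w))))
    ≡⟨ sym (∑-filter P? L _) ⟩
  ∑ (filter P? L) (λ x → ∑ (words k (filter P? L)) (λ w → F (x ∷ w)))
    ≡⟨ sym (∑-words-suc k (filter P? L) F) ⟩
  ∑ (words (suc k) (filter P? L)) F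
    ∎
  where
  first-letter : ∀ x → ∑ (words k L) (λ w → when (does (P? x) ∧ does (all? P? w)) (F (x ∷ w)))
                     ≡ when (does (P? x)) (∑ (words k (filter P? L)) (λ w → F (x ∷ w)))
  first-letter x with does (P? x)
  ... | true  = ∑-words-all P? k L (λ w → F (x ∷ w))
  ... | false = ∑-zero (words k L)

-- signedVals n is signed (upTo n) by definition, so Bn n unfolds to filter isSignedPerm? (words n (signed (upTo n))).
signed : List ℕ → List ℤ
signed = concatMap (λ i → + suc i ∷ -[1+ i ] ∷ [])

∑-signed : (U : List ℕ) (f : ℤ → ℤ) → ∑ (signed U) f ≡ ∑ U (λ i → f (+ suc i) + f -[1+ i ])
∑-signed U f = trans (∑-concatMap U _ f) (∑-cong U (λ i → cong (_+_ (f (+ suc i))) (ℤ.+-identityʳ _)))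

module _ {A : Set} {R : Rel A 0ℓ} where

  AllPairs-∷ʳ⁺ : ∀ {xs x} → AllPairs R xs → All (λ y → R y x) xs → AllPairs R (xs ∷ʳ x)
  AllPairs-∷ʳ⁺ []       []       = [] ∷ []
  AllPairs-∷ʳ⁺ (p ∷ ps) (r ∷ rs) = All.∷ʳ⁺ p r ∷ AllPairs-∷ʳ⁺ ps rs

  AllPairs-∷ʳ⁻ : ∀ xs {x} → AllPairs R (xs ∷ʳ x) → AllPairs R xs × All (λ y → R y x) xs
  AllPairs-∷ʳ⁻ []       _        = [] , []
  AllPairs-∷ʳ⁻ (y ∷ xs) (p ∷ ps) with All.∷ʳ⁻ p | AllPairs-∷ʳ⁻ xs ps
  ... | p′ , r | ps′ , rs = p′ ∷ ps′ , r ∷ rs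

≢? : (c : ℕ) → Decidable (_≢ c)
≢? c i = ¬? (i ℕ.≟ c)

abs≢? : (n : ℕ) → Decidable (λ y → ∣ y ∣ ≢ n)
abs≢? n y = ≢? n ∣ y ∣

IsSignedPerm-∷ʳ : ∀ w x → IsSignedPerm (w ∷ʳ x) ⇔ (IsSignedPerm w × All (λ y → ∣ y ∣ ≢ ∣ x ∣) w)
IsSignedPerm-∷ʳ w x = mk⇔ to from
  where
  to : IsSignedPerm (w ∷ʳ x) → IsSignedPerm w × All (λ y → ∣ y ∣ ≢ ∣ x ∣) w
  to u with AllPairs-∷ʳ⁻ (map ∣_∣ w) (subst (AllPairs _) (map-++ ∣_∣ w (x ∷ [])) u)
  ... | uw , avoid = uw , All.map⁻ avoid
  from : IsSignedPerm w × All (λ y → ∣ y ∣ ≢ ∣ x ∣) w → IsSignedPerm (w ∷ʳ x)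
  from (uw , avoid) = subst (AllPairs _) (sym (map-++ ∣_∣ w (x ∷ []))) (AllPairs-∷ʳ⁺ uw (All.map⁺ avoid))

when-isSignedPerm-∷ʳ : ∀ w x v → when (does (isSignedPerm? (w ∷ʳ x))) v
                                 ≡ when (does (all? (abs≢? ∣ x ∣) w)) (when (does (isSignedPerm? w)) v)
when-isSignedPerm-∷ʳ w x v = begin
  when (does (isSignedPerm? (w ∷ʳ x))) v
    ≡⟨ cong (λ b → when b v) (does-⇔ (IsSignedPerm-∷ʳ w x) (isSignedPerm? (w ∷ʳ x))
                                      (isSignedPerm? w ×-dec all? (abs≢? ∣ x ∣) w)) ⟩
  when (does (isSignedPerm? w) ∧ does (all? (abs≢? ∣ x ∣) w)) v
    ≡⟨ when-∧ (does (isSignedPerm? w)) (does (all? (abs≢? ∣ x ∣) w)) v ⟩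
  when (does (all? (abs≢? ∣ x ∣) w)) (when (does (isSignedPerm? w)) v)
    ∎

module _ {A B : Set} {_<₁_ : Rel A 0ℓ} {_<₂_ : Rel B 0ℓ}
         (compare : Trichotomous _≡_ _<₁_) (irrefl : Irreflexive _≡_ _<₂_) (asym : Asymmetric _<₂_)
         {f : A → B} (f-mono : Monotonic₁ _<₁_ _<₂_ f) where

  strictMono⇒reflects : ∀ {x y} → f x <₂ f y → x <₁ y
  strictMono⇒reflects {x} {y} fx<fy with compare x y
  ... | tri< x<y _ _ = x<y
  ... | tri≈ _ refl _ = ⊥-elim (irrefl refl fx<fy)
  ... | tri> _ _ y<x = ⊥-elim (asym fx<fy (f-mono y<x))

  strictMono⇒injective : ∀ {x y} → f x ≡ f y → x ≡ y
  strictMono⇒injective {x} {y} fx≡fy with compare x y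
  ... | tri< x<y _ _ = ⊥-elim (irrefl fx≡fy (f-mono x<y))
  ... | tri≈ _ x≡y _ = x≡y
  ... | tri> _ _ y<x = ⊥-elim (irrefl (sym fx≡fy) (f-mono y<x))

OrderEmbedding : (ℕ → ℕ) → Set
OrderEmbedding = Monotonic₁ ℕ._<_ ℕ._<_

orderEmbedding-injective : {φ : ℕ → ℕ} → OrderEmbedding φ → ∀ {i j} → φ i ≡ φ j → i ≡ j
orderEmbedding-injective = strictMono⇒injective ℕ.<-cmp ℕ.<-irrefl ℕ.<-asym

relabel : (ℕ → ℕ) → ℤ → ℤ
relabel φ (+ zero)  = + zero
relabel φ (+ suc i) = + suc (φ i)
relabel φ -[1+ i ]  = -[1+ φ i ]

relabelAbs : (ℕ → ℕ) → ℕ → ℕ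
relabelAbs φ zero    = zero
relabelAbs φ (suc i) = suc (φ i)

module _ {φ : ℕ → ℕ} (φ-mono : OrderEmbedding φ) where

  relabel-mono : Monotonic₁ ℤ._<_ ℤ._<_ (relabel φ)
  relabel-mono (-<- i<j)                      = -<- (φ-mono i<j)
  relabel-mono (-<+ {n = zero})               = -<+
  relabel-mono (-<+ {n = suc n})              = -<+
  relabel-mono (+<+ {zero} {suc n} _)         = +<+ (s≤s z≤n)
  relabel-mono (+<+ {suc m} {suc n} (s≤s i<j)) = +<+ (s≤s (φ-mono i<j))

  relabel-<? : ∀ x y → does (relabel φ x <? relabel φ y) ≡ does (x <? y)
  relabel-<? x y = does-⇔ (mk⇔ (strictMono⇒reflects ℤ.<-cmp ℤ.<-irrefl ℤ.<-asym relabel-mono) relabel-mono)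
                          (relabel φ x <? relabel φ y) (x <? y)

  relabelAbs-injective : ∀ {a b} → relabelAbs φ a ≡ relabelAbs φ b → a ≡ b
  relabelAbs-injective {zero}  {zero}  _  = refl
  relabelAbs-injective {suc a} {suc b} eq = cong suc (orderEmbedding-injective φ-mono (ℕ.suc-injective eq))

  IsSignedPerm-relabel : ∀ w → IsSignedPerm (map (relabel φ) w) ⇔ IsSignedPerm w
  IsSignedPerm-relabel w = mk⇔ (Unique.map⁻ ∘ subst Unique (abs-relabel w))
                                (subst Unique (sym (abs-relabel w)) ∘ Unique.map⁺ relabelAbs-injective)
    where
    abs-relabel : ∀ w → map ∣_∣ (map (relabel φ) w) ≡ map (relabelAbs φ) (map ∣_∣ w)
    abs-relabel []              = refl
    abs-relabel (+ zero ∷ w)    = cong (zero ∷_) (abs-relabel w)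
    abs-relabel (+ suc i ∷ w)   = cong (suc (φ i) ∷_) (abs-relabel w)
    abs-relabel (-[1+ i ] ∷ w)  = cong (suc (φ i) ∷_) (abs-relabel w)

signed-map : (φ : ℕ → ℕ) (V : List ℕ) → signed (map φ V) ≡ map (relabel φ) (signed V)
signed-map φ []      = refl
signed-map φ (i ∷ V) = cong (λ l → + suc (φ i) ∷ -[1+ φ i ] ∷ l) (signed-map φ V)

relabel-◃ : (φ : ℕ → ℕ) → ∀ s c → relabel φ (s ◃ suc c) ≡ s ◃ suc (φ c)
relabel-◃ φ Sign.+ c = refl
relabel-◃ φ Sign.- c = refl

filter-signed : ∀ j U → filter (abs≢? (suc j)) (signed U) ≡ signed (filter (≢? j) U)
filter-signed j []      = refl
filter-signed j (i ∷ U) with i ℕ.≡ᵇ j in i≡ᵇj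
... | true  rewrite i≡ᵇj = filter-signed j U
... | false rewrite i≡ᵇj = cong (λ l → + suc i ∷ -[1+ i ] ∷ l) (filter-signed j U)

filter-≢-map : {f : ℕ → ℕ} → (∀ {a b} → f a ≡ f b → a ≡ b) → ∀ c L →
               filter (≢? (f c)) (map f L) ≡ map f (filter (≢? c) L)
filter-≢-map         f-inj c []      = refl
filter-≢-map {f = f} f-inj c (i ∷ L) with i ℕ.≟ c
... | yes refl = begin
  filter (≢? (f i)) (f i ∷ map f L) ≡⟨ filter-reject (≢? (f i)) (λ fi≢fi → fi≢fi refl) ⟩
  filter (≢? (f i)) (map f L)       ≡⟨ filter-≢-map f-inj i L ⟩
  map f (filter (≢? i) L)           ≡⟨ cong (map f) (filter-reject (≢? i) (λ i≢i → i≢i refl)) ⟨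
  map f (filter (≢? i) (i ∷ L))     ∎
... | no i≢c = begin
  filter (≢? (f c)) (f i ∷ map f L)   ≡⟨ filter-accept (≢? (f c)) (λ fi≡fc → i≢c (f-inj fi≡fc)) ⟩
  f i ∷ filter (≢? (f c)) (map f L)   ≡⟨ cong (f i ∷_) (filter-≢-map f-inj c L) ⟩
  f i ∷ map f (filter (≢? c) L)       ≡⟨ cong (map f) (filter-accept (≢? c) i≢c) ⟨
  map f (filter (≢? c) (i ∷ L))       ∎

punchIn : ℕ → ℕ → ℕ
punchIn zero    j       = suc j
punchIn (suc c) zero    = zero
punchIn (suc c) (suc j) = suc (punchIn c j)

punchIn-mono : ∀ c → OrderEmbedding (punchIn c)
punchIn-mono zero    i<j                   = s≤s i<j
punchIn-mono (suc c) {zero}  {suc j} _     = s≤s z≤n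
punchIn-mono (suc c) {suc i} {suc j} (s≤s i<j) = s≤s (punchIn-mono c i<j)

punchIn-<ᵇ : ∀ i c → (i <ᵇ punchIn i c) ≡ (i ≤ᵇ c)
punchIn-<ᵇ zero    c       = refl
punchIn-<ᵇ (suc i) zero    = refl
punchIn-<ᵇ (suc i) (suc c) = trans (punchIn-<ᵇ i c) (≤ᵇ-<ᵇ-suc i c)

upTo-suc : ∀ n → upTo (suc n) ≡ 0 ∷ map suc (upTo n)
upTo-suc n = cong (0 ∷_) (sym (map-applyUpTo (λ x → x) suc n))

filter-≢-upTo : ∀ {c k} → c ≤ k → filter (≢? c) (upTo (suc k)) ≡ map (punchIn c) (upTo k)
filter-≢-upTo {zero}  {k}     _         = begin
  filter (≢? 0) (upTo (suc k))     ≡⟨ cong (filter (≢? 0)) (upTo-suc k) ⟩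
  filter (≢? 0) (map suc (upTo k)) ≡⟨ filter-all (≢? 0) (All.map⁺ (All.universal (λ _ ()) (upTo k))) ⟩
  map suc (upTo k)                 ∎
filter-≢-upTo {suc c} {suc k} (s≤s c≤k) = begin
  filter (≢? (suc c)) (upTo (suc (suc k)))
    ≡⟨ cong (filter (≢? (suc c))) (upTo-suc (suc k)) ⟩
  0 ∷ filter (≢? (suc c)) (map suc (upTo (suc k)))
    ≡⟨ cong (0 ∷_) (filter-≢-map ℕ.suc-injective c (upTo (suc k))) ⟩
  0 ∷ map suc (filter (≢? c) (upTo (suc k)))
    ≡⟨ cong (λ L → 0 ∷ map suc L) (filter-≢-upTo c≤k) ⟩
  0 ∷ map suc (map (punchIn c) (upTo k))
    ≡⟨ cong (0 ∷_) (trans (sym (map-∘ (upTo k))) (map-∘ (upTo k))) ⟩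
  map (punchIn (suc c)) (0 ∷ map suc (upTo k))
    ≡⟨ cong (map (punchIn (suc c))) (upTo-suc k) ⟨
  map (punchIn (suc c)) (upTo (suc k))
    ∎

descent : ℤ → ℤ → ℕ
descent x y = if does (y <? x) then 1 else 0

descents-∷ʳ : ∀ l x b → descents (l ++ x ∷ b ∷ []) ≡ descents (l ∷ʳ x) ℕ.+ descent x b
descents-∷ʳ []           x b = ℕ.+-identityʳ (descent x b)
descents-∷ʳ (a ∷ [])     x b =
  trans (cong (descent a x ℕ.+_) (descents-∷ʳ [] x b)) (sym (ℕ.+-assoc (descent a x) _ _))
descents-∷ʳ (a ∷ a′ ∷ l) x b =
  trans (cong (descent a a′ ℕ.+_) (descents-∷ʳ (a′ ∷ l) x b)) (sym (ℕ.+-assoc (descent a a′) _ _))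

descents-relabel : {φ : ℕ → ℕ} → OrderEmbedding φ → ∀ l → descents (map (relabel φ) l) ≡ descents l
descents-relabel φ-mono []          = refl
descents-relabel φ-mono (x ∷ [])    = refl
descents-relabel φ-mono (x ∷ y ∷ l) =
  cong₂ (λ b n → (if b then 1 else 0) ℕ.+ n) (relabel-<? φ-mono y x) (descents-relabel φ-mono (y ∷ l))

last-∷ʳ : ∀ (w : List ℤ) x → last (w ∷ʳ x) ≡ just x
last-∷ʳ []           x = refl
last-∷ʳ (a ∷ [])     x = refl
last-∷ʳ (a ∷ a′ ∷ w) x = last-∷ʳ (a′ ∷ w) x

lastPos?-∷ʳ : ∀ w x → does (lastPos? (w ∷ʳ x)) ≡ does (0ℤ <? x)
lastPos?-∷ʳ w x with last (w ∷ʳ x) | last-∷ʳ w x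
... | _ | refl = refl

module _ (t : ℤ) where

  beforeWeight : ℤ → List ℤ → ℤ
  beforeWeight b w = when (does (isSignedPerm? w)) (t ^ descents (0ℤ ∷ w ++ b ∷ []))

  desPolyBefore : ℕ → List ℕ → ℤ → ℤ
  desPolyBefore k V b = ∑ (words k (signed V)) (beforeWeight b)

  desPolyBefore-relabel : {φ : ℕ → ℕ} → OrderEmbedding φ → ∀ k V b →
                          desPolyBefore k (map φ V) (relabel φ b) ≡ desPolyBefore k V b
  desPolyBefore-relabel {φ} φ-mono k V b = begin
    desPolyBefore k (map φ V) (relabel φ b)
      ≡⟨ cong (λ L → ∑ (words k L) (beforeWeight (relabel φ b))) (signed-map φ V) ⟩
    ∑ (words k (map (relabel φ) (signed V))) (beforeWeight (relabel φ b))
      ≡⟨ ∑-words-map k (signed V) (relabel φ) (beforeWeight (relabel φ b)) ⟩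
    ∑ (words k (signed V)) (λ w → beforeWeight (relabel φ b) (map (relabel φ) w))
      ≡⟨ ∑-cong (words k (signed V)) relabelled ⟩
    desPolyBefore k V b
      ∎
    where
    relabelled : ∀ w → beforeWeight (relabel φ b) (map (relabel φ) w) ≡ beforeWeight b w
    relabelled w = cong₂ (λ p n → when p (t ^ n))
      (does-⇔ (IsSignedPerm-relabel φ-mono w) (isSignedPerm? (map (relabel φ) w)) (isSignedPerm? w))
      (trans (cong (λ l → descents (0ℤ ∷ l)) (sym (map-++ (relabel φ) w (b ∷ []))))
             (descents-relabel φ-mono (0ℤ ∷ w ++ b ∷ [])))

  -- for ∣ b ∣ = c + 1 this is the generating function of the π ∈ B_{k+1} with π(k+1) = b
  endPoly : ℕ → ℕ → ℤ → ℤ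
  endPoly k c b = desPolyBefore k (map (punchIn c) (upTo k)) b

  endingWeight : ℤ → List ℤ → ℤ
  endingWeight x w = when (does (isSignedPerm? (w ∷ʳ x))) (t ^ descents (0ℤ ∷ w ++ x ∷ []))

  desPolyEndingIn : ℕ → List ℕ → ℤ → ℤ
  desPolyEndingIn k V x = ∑ (words k (signed V)) (endingWeight x)

  desPolyEndingIn-◃ : ∀ k V s i →
                      desPolyEndingIn k V (s ◃ suc i) ≡ desPolyBefore k (filter (≢? i) V) (s ◃ suc i)
  desPolyEndingIn-◃ k V s i = begin
    desPolyEndingIn k V x
      ≡⟨ ∑-cong (words k (signed V)) (λ w → when-isSignedPerm-∷ʳ w x (T w)) ⟩
    ∑ (words k (signed V)) (λ w → when (does (all? (abs≢? ∣ x ∣) w)) (when (does (isSignedPerm? w)) (T w)))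
      ≡⟨ ∑-words-all (abs≢? ∣ x ∣) k (signed V) (λ w → when (does (isSignedPerm? w)) (T w)) ⟩
    ∑ (words k (filter (abs≢? ∣ x ∣) (signed V))) (λ w → when (does (isSignedPerm? w)) (T w))
      ≡⟨ cong (λ L → ∑ (words k L) (λ w → when (does (isSignedPerm? w)) (T w)))
              (trans (cong (λ n → filter (abs≢? n) (signed V)) (ℤ.abs-◃ s (suc i))) (filter-signed i V)) ⟩
    desPolyBefore k (filter (≢? i) V) x
      ∎
    where
    x = s ◃ suc i
    T : List ℤ → ℤ
    T w = t ^ descents (0ℤ ∷ w ++ x ∷ [])

  desPolyEndingIn-standardise : {φ : ℕ → ℕ} → OrderEmbedding φ → ∀ {c k} → c < suc k → ∀ s →
    desPolyEndingIn k (map φ (upTo (suc k))) (s ◃ suc (φ c)) ≡ endPoly k c (s ◃ suc c)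
  desPolyEndingIn-standardise {φ} φ-mono {c} {k} c≤k s = begin
    desPolyEndingIn k (map φ (upTo (suc k))) (s ◃ suc (φ c))
      ≡⟨ desPolyEndingIn-◃ k (map φ (upTo (suc k))) s (φ c) ⟩
    desPolyBefore k (filter (≢? (φ c)) (map φ (upTo (suc k)))) (s ◃ suc (φ c))
      ≡⟨ cong (λ V → desPolyBefore k V (s ◃ suc (φ c)))
              (trans (filter-≢-map (orderEmbedding-injective φ-mono) c (upTo (suc k)))
                     (cong (map φ) (filter-≢-upTo (ℕ.≤-pred c≤k)))) ⟩
    desPolyBefore k (map φ (map (punchIn c) (upTo k))) (s ◃ suc (φ c))
      ≡⟨ cong (desPolyBefore k (map φ (map (punchIn c) (upTo k)))) (relabel-◃ φ s c) ⟨
    desPolyBefore k (map φ (map (punchIn c) (upTo k))) (relabel φ (s ◃ suc c))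
      ≡⟨ desPolyBefore-relabel φ-mono k (map (punchIn c) (upTo k)) (s ◃ suc c) ⟩
    endPoly k c (s ◃ suc c)
      ∎

  lastLetter-decomposition :
    {φ : ℕ → ℕ} → OrderEmbedding φ → ∀ k (h : List ℤ → ℤ) (g : ℤ → ℤ) →
    (∀ w x → h (w ∷ʳ x) ≡ g x * endingWeight x w) →
    ∑ (words (suc k) (signed (map φ (upTo (suc k))))) h
      ≡ ∑< (suc k) (λ c → g (+ suc (φ c)) * endPoly k c (+ suc c) + g -[1+ φ c ] * endPoly k c -[1+ c ])
  lastLetter-decomposition {φ} φ-mono k h g h-∷ʳ = begin
    ∑ (words (suc k) (signed V)) h
      ≡⟨ ∑-words-∷ʳ k (signed V) h ⟩
    ∑ (signed V) (λ x → ∑ (words k (signed V)) (λ w → h (w ∷ʳ x)))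
      ≡⟨ ∑-cong (signed V) (λ x → trans (∑-cong (words k (signed V)) (λ w → h-∷ʳ w x))
                                        (∑-* (words k (signed V)) (g x) (endingWeight x))) ⟩
    ∑ (signed V) (λ x → g x * desPolyEndingIn k V x)
      ≡⟨ ∑-signed V (λ x → g x * desPolyEndingIn k V x) ⟩
    ∑ V G
      ≡⟨ ∑-map (upTo (suc k)) φ G ⟩
    ∑ (upTo (suc k)) (λ c → G (φ c))
      ≡⟨ ∑-upTo (suc k) (λ c → G (φ c)) ⟩
    ∑< (suc k) (λ c → G (φ c))
      ≡⟨ ∑<-cong (suc k) (λ c c<1+k → cong₂ (λ p q → g (+ suc (φ c)) * p + g -[1+ φ c ] * q)
                                            (desPolyEndingIn-standardise φ-mono c<1+k Sign.+)
                                            (desPolyEndingIn-standardise φ-mono c<1+k Sign.-)) ⟩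
    ∑< (suc k) (λ c → g (+ suc (φ c)) * endPoly k c (+ suc c) + g -[1+ φ c ] * endPoly k c -[1+ c ])
      ∎
    where
    V = map φ (upTo (suc k))
    G : ℕ → ℤ
    G i = g (+ suc i) * desPolyEndingIn k V (+ suc i) + g -[1+ i ] * desPolyEndingIn k V -[1+ i ]

  lastLetter-decomposition-upTo :
    ∀ k (h : List ℤ → ℤ) (g : ℤ → ℤ) → (∀ w x → h (w ∷ʳ x) ≡ g x * endingWeight x w) →
    ∑ (words (suc k) (signed (upTo (suc k)))) h
      ≡ ∑< (suc k) (λ c → g (+ suc c) * endPoly k c (+ suc c) + g -[1+ c ] * endPoly k c -[1+ c ])
  lastLetter-decomposition-upTo k h g h-∷ʳ =
    trans (cong (λ V → ∑ (words (suc k) (signed V)) h) (sym (map-id (upTo (suc k)))))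
          (lastLetter-decomposition (λ c<d → c<d) k h g h-∷ʳ)

  Bpoly-rec : ∀ k → Bpoly (suc k) t ≡ ∑< (suc k) (λ c → endPoly k c (+ suc c) + endPoly k c -[1+ c ])
  Bpoly-rec k = begin
    Bpoly (suc k) t
      ≡⟨ ∑-filter isSignedPerm? (words (suc k) (signed (upTo (suc k)))) (λ w → t ^ desB w) ⟩
    ∑ (words (suc k) (signed (upTo (suc k)))) h
      ≡⟨ lastLetter-decomposition-upTo k h (λ _ → 1ℤ) (λ w x → sym (ℤ.*-identityˡ (h (w ∷ʳ x)))) ⟩
    ∑< (suc k) (λ c → 1ℤ * endPoly k c (+ suc c) + 1ℤ * endPoly k c -[1+ c ])
      ≡⟨ ∑<-cong (suc k) (λ c _ → cong₂ _+_ (ℤ.*-identityˡ (endPoly k c (+ suc c)))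
                                           (ℤ.*-identityˡ (endPoly k c -[1+ c ]))) ⟩
    ∑< (suc k) (λ c → endPoly k c (+ suc c) + endPoly k c -[1+ c ])
      ∎
    where
    h : List ℤ → ℤ
    h w = when (does (isSignedPerm? w)) (t ^ desB w)

  desPoly-Bn⁺-rec : ∀ k → desPoly (Bn⁺ (suc k)) t ≡ ∑< (suc k) (λ c → endPoly k c (+ suc c))
  desPoly-Bn⁺-rec k = begin
    desPoly (Bn⁺ (suc k)) t
      ≡⟨ ∑-filter lastPos? (Bn (suc k)) (λ w → t ^ desB w) ⟩
    ∑ (Bn (suc k)) (λ w → when (does (lastPos? w)) (t ^ desB w))
      ≡⟨ ∑-filter isSignedPerm? (words (suc k) (signed (upTo (suc k))))
                  (λ w → when (does (lastPos? w)) (t ^ desB w)) ⟩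
    ∑ (words (suc k) (signed (upTo (suc k)))) h
      ≡⟨ lastLetter-decomposition-upTo k h positive h-∷ʳ ⟩
    ∑< (suc k) (λ c → 1ℤ * endPoly k c (+ suc c) + 0ℤ * endPoly k c -[1+ c ])
      ≡⟨ ∑<-cong (suc k) (λ c _ → trans (ℤ.+-identityʳ (1ℤ * endPoly k c (+ suc c)))
                                         (ℤ.*-identityˡ (endPoly k c (+ suc c)))) ⟩
    ∑< (suc k) (λ c → endPoly k c (+ suc c))
      ∎
    where
    h : List ℤ → ℤ
    h w = when (does (isSignedPerm? w)) (when (does (lastPos? w)) (t ^ desB w))
    positive : ℤ → ℤ
    positive x = when (does (0ℤ <? x)) 1ℤ
    h-∷ʳ : ∀ w x → h (w ∷ʳ x) ≡ positive x * endingWeight x w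
    h-∷ʳ w x rewrite lastPos?-∷ʳ w x =
      when-when (does (isSignedPerm? (w ∷ʳ x))) (does (0ℤ <? x)) (t ^ desB (w ∷ʳ x))

  endPoly-rec : ∀ k i → endPoly (suc k) i (+ suc i)
                        ≡ ∑< (suc k) (λ c → t ^ (if i ≤ᵇ c then 1 else 0) * endPoly k c (+ suc c)
                                            + endPoly k c -[1+ c ])
  endPoly-rec k i = begin
    endPoly (suc k) i b
      ≡⟨ lastLetter-decomposition (punchIn-mono i) k (beforeWeight b) (λ x → t ^ descent x b) h-∷ʳ ⟩
    ∑< (suc k) (λ c → t ^ (if i <ᵇ punchIn i c then 1 else 0) * endPoly k c (+ suc c) + 1ℤ * endPoly k c -[1+ c ])
      ≡⟨ ∑<-cong (suc k) (λ c _ → cong₂ (λ e p → t ^ (if e then 1 else 0) * endPoly k c (+ suc c) + p)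
                                          (punchIn-<ᵇ i c) (ℤ.*-identityˡ (endPoly k c -[1+ c ]))) ⟩
    ∑< (suc k) (λ c → t ^ (if i ≤ᵇ c then 1 else 0) * endPoly k c (+ suc c) + endPoly k c -[1+ c ])
      ∎
    where
    b = + suc i
    h-∷ʳ : ∀ w x → beforeWeight b (w ∷ʳ x) ≡ t ^ descent x b * endingWeight x w
    h-∷ʳ w x = begin
      when sp (t ^ descents (0ℤ ∷ (w ∷ʳ x) ++ b ∷ []))
        ≡⟨ cong (λ l → when sp (t ^ descents (0ℤ ∷ l))) (++-assoc w (x ∷ []) (b ∷ [])) ⟩
      when sp (t ^ descents (0ℤ ∷ w ++ x ∷ b ∷ []))
        ≡⟨ cong (λ n → when sp (t ^ n)) (descents-∷ʳ (0ℤ ∷ w) x b) ⟩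
      when sp (t ^ (descents (0ℤ ∷ w ++ x ∷ []) ℕ.+ descent x b))
        ≡⟨ cong (when sp) (trans (ℤ.^-distribˡ-+-* t D (descent x b)) (ℤ.*-comm (t ^ D) (t ^ descent x b))) ⟩
      when sp (t ^ descent x b * t ^ descents (0ℤ ∷ w ++ x ∷ []))
        ≡⟨ when-* sp (t ^ descent x b) (t ^ D) ⟩
      t ^ descent x b * when sp (t ^ descents (0ℤ ∷ w ++ x ∷ []))
        ∎
      where
      sp = does (isSignedPerm? (w ∷ʳ x))
      D = descents (0ℤ ∷ w ++ x ∷ [])

-- β k, a k c and ā k c stand for B_k(t) and the descent generating functions of the π ∈ B_{k+1} with
-- π(k+1) = c+1, resp. -(c+1).
module ClosedForm
  (t : ℤ) (β : ℕ → ℤ) (a ā : ℕ → ℕ → ℤ)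
  (a-zero : a 0 0 ≡ β 0)
  (β-rec : ∀ k → β (suc k) ≡ ∑< (suc k) (λ c → a k c + ā k c))
  (a-rec : ∀ k i → a (suc k) i ≡ ∑< (suc k) (λ c → t ^ (if i ≤ᵇ c then 1 else 0) * a k c + ā k c))
  where

  y : ℤ
  y = t - 1ℤ

  P : ℕ → ℕ → ℤ
  P r k = ∑< (suc k) (λ j → + (r C j) * y ^ j * β (k ∸ j))

  ∑<-P : ∀ r k → ∑< r (λ q → P q k) ≡ ∑< (suc k) (λ j → + (r C suc j) * y ^ j * β (k ∸ j))
  ∑<-P r k = begin
    ∑< r (λ q → P q k)
      ≡⟨ ∑<-swap r (suc k) (λ q j → + (q C j) * y ^ j * β (k ∸ j)) ⟩
    ∑< (suc k) (λ j → ∑< r (λ q → + (q C j) * y ^ j * β (k ∸ j)))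
      ≡⟨ ∑<-cong (suc k) (λ j _ → trans (∑<-cong r (λ q _ → rotate (+ (q C j)) (y ^ j) (β (k ∸ j))))
                                         (∑<-* r (y ^ j * β (k ∸ j)) (λ q → + (q C j)))) ⟩
    ∑< (suc k) (λ j → y ^ j * β (k ∸ j) * ∑< r (λ q → + (q C j)))
      ≡⟨ ∑<-cong (suc k) (λ j _ → trans (cong (y ^ j * β (k ∸ j) *_) (hockeyStick r j))
                                         (sym (rotate (+ (r C suc j)) (y ^ j) (β (k ∸ j))))) ⟩
    ∑< (suc k) (λ j → + (r C suc j) * y ^ j * β (k ∸ j))
      ∎
    where
    rotate : ∀ c Y B → c * Y * B ≡ Y * B * c
    rotate = solve-∀

  P-suc : ∀ r k → P r (suc k) ≡ β (suc k) + y * ∑< r (λ q → P q k)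
  P-suc r k = begin
    P r (suc k)
      ≡⟨ ∑<-shift (suc k) (λ j → + (r C j) * y ^ j * β (suc k ∸ j)) ⟩
    1ℤ * 1ℤ * β (suc k) + ∑< (suc k) (λ j → + (r C suc j) * (y * y ^ j) * β (k ∸ j))
      ≡⟨ cong₂ _+_ (one-one (β (suc k)))
                   (trans (∑<-cong (suc k) (λ j _ → pull-y (+ (r C suc j)) (y ^ j) (β (k ∸ j)) y))
                          (∑<-* (suc k) y (λ j → + (r C suc j) * y ^ j * β (k ∸ j)))) ⟩
    β (suc k) + y * ∑< (suc k) (λ j → + (r C suc j) * y ^ j * β (k ∸ j))
      ≡⟨ cong (λ s → β (suc k) + y * s) (∑<-P r k) ⟨
    β (suc k) + y * ∑< r (λ q → P q k)
      ∎
    where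
    one-one : ∀ b → 1ℤ * 1ℤ * b ≡ b
    one-one = solve-∀
    pull-y : ∀ c Y B y → c * (y * Y) * B ≡ y * (c * Y * B)
    pull-y = solve-∀

  a-suc : ∀ k i → a (suc k) i ≡ β (suc k) + y * ∑< (suc k) (λ c → when (i ≤ᵇ c) (a k c))
  a-suc k i = begin
    a (suc k) i
      ≡⟨ a-rec k i ⟩
    ∑< (suc k) (λ c → t ^ (if i ≤ᵇ c then 1 else 0) * a k c + ā k c)
      ≡⟨ ∑<-cong (suc k) (λ c _ → split (i ≤ᵇ c) (a k c) (ā k c)) ⟩
    ∑< (suc k) (λ c → (a k c + ā k c) + y * when (i ≤ᵇ c) (a k c))
      ≡⟨ ∑<-+ (suc k) (λ c → a k c + ā k c) (λ c → y * when (i ≤ᵇ c) (a k c)) ⟩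
    ∑< (suc k) (λ c → a k c + ā k c) + ∑< (suc k) (λ c → y * when (i ≤ᵇ c) (a k c))
      ≡⟨ cong₂ _+_ (sym (β-rec k)) (∑<-* (suc k) y (λ c → when (i ≤ᵇ c) (a k c))) ⟩
    β (suc k) + y * ∑< (suc k) (λ c → when (i ≤ᵇ c) (a k c))
      ∎
    where
    split : ∀ b p q → t ^ (if b then 1 else 0) * p + q ≡ (p + q) + y * when b p
    split true  p q = descent-split t p q
      where
      descent-split : ∀ t p q → t * 1ℤ * p + q ≡ (p + q) + (t - 1ℤ) * p
      descent-split = solve-∀
    split false p q = ascent-split t p q
      where
      ascent-split : ∀ t p q → 1ℤ * p + q ≡ (p + q) + (t - 1ℤ) * 0ℤ
      ascent-split = solve-∀

  a-closedForm : ∀ k i → i ≤ k → a k i ≡ P (k ∸ i) k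
  a-closedForm zero    zero z≤n = trans a-zero (one-one (β 0))
    where
    one-one : ∀ b → b ≡ 0ℤ + 1ℤ * 1ℤ * b
    one-one = solve-∀
  a-closedForm (suc k) i _ = begin
    a (suc k) i
      ≡⟨ a-suc k i ⟩
    β (suc k) + y * ∑< (suc k) (λ c → when (i ≤ᵇ c) (a k c))
      ≡⟨ cong (λ s → β (suc k) + y * s)
              (∑<-cong (suc k) (λ c c<1+k → cong (when (i ≤ᵇ c)) (a-closedForm k c (ℕ.≤-pred c<1+k)))) ⟩
    β (suc k) + y * ∑< (suc k) (λ c → when (i ≤ᵇ c) (P (k ∸ c) k))
      ≡⟨ cong (λ s → β (suc k) + y * s) (∑<-from i (suc k) (λ r → P r k)) ⟩
    β (suc k) + y * ∑< (suc k ∸ i) (λ r → P r k)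
      ≡⟨ P-suc (suc k ∸ i) k ⟨
    P (suc k ∸ i) (suc k)
      ∎

  ∑-a-closedForm : ∀ m → let n = suc m in
    ∑< n (a m) ≡ sumℤ (map (λ k → + (n C k) * β k * y ^ (n ∸ k ∸ 1)) (upTo n))
  ∑-a-closedForm m = begin
    ∑< n (a m)
      ≡⟨ ∑<-cong n (λ c c<n → a-closedForm m c (ℕ.≤-pred c<n)) ⟩
    ∑< n (λ c → P (m ∸ c) m)
      ≡⟨ ∑<-reverse n (λ r → P r m) ⟨
    ∑< n (λ r → P r m)
      ≡⟨ ∑<-P n m ⟩
    ∑< n (λ j → + (n C suc j) * y ^ j * β (m ∸ j))
      ≡⟨ ∑<-cong n (λ j j<n → complement j (ℕ.≤-pred j<n)) ⟩
    ∑< n (λ j → G (n ∸ suc j))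
      ≡⟨ ∑<-reverse n G ⟨
    ∑< n G
      ≡⟨ ∑-upTo n G ⟨
    sumℤ (map G (upTo n))
      ∎
    where
    n = suc m
    G : ℕ → ℤ
    G k = + (n C k) * β k * y ^ (n ∸ k ∸ 1)
    complement : ∀ j → j ≤ m → + (n C suc j) * y ^ j * β (m ∸ j) ≡ G (m ∸ j)
    complement j j≤m = begin
      + (n C suc j) * y ^ j * β (m ∸ j)
        ≡⟨ cong (λ e → + (n C e) * y ^ j * β (m ∸ j)) n∸[m∸j]≡1+j ⟨
      + (n C (n ∸ (m ∸ j))) * y ^ j * β (m ∸ j)
        ≡⟨ cong (λ c → + c * y ^ j * β (m ∸ j)) (nCk≡nC[n∸k] (ℕ.m≤n⇒m≤1+n (ℕ.m∸n≤m m j))) ⟨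
      + (n C (m ∸ j)) * y ^ j * β (m ∸ j)
        ≡⟨ swap (+ (n C (m ∸ j))) (y ^ j) (β (m ∸ j)) ⟩
      + (n C (m ∸ j)) * β (m ∸ j) * y ^ j
        ≡⟨ cong (λ e → + (n C (m ∸ j)) * β (m ∸ j) * y ^ (e ∸ 1)) n∸[m∸j]≡1+j ⟨
      G (m ∸ j)
        ∎
      where
      n∸[m∸j]≡1+j : n ∸ (m ∸ j) ≡ suc j
      n∸[m∸j]≡1+j = trans (ℕ.+-∸-assoc 1 (ℕ.m∸n≤m m j)) (cong suc (ℕ.m∸[m∸n]≡n j≤m))
      swap : ∀ c Y B → c * Y * B ≡ c * B * Y
      swap = solve-∀

lemma2p1 : (m : ℕ) (t : ℤ) →
    let n = suc m in
    desPoly (Bn⁺ n) t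
      ≡ sumℤ (map (λ k → (+ (n C k)) * Bpoly k t * ((t - 1ℤ) ^ (n ∸ k ∸ 1))) (upTo n))
lemma2p1 m t = trans (desPoly-Bn⁺-rec t m) (∑-a-closedForm m)
  where
  open ClosedForm t (λ k → Bpoly k t) (λ k c → endPoly t k c (+ suc c)) (λ k c → endPoly t k c -[1+ c ])
                  refl (Bpoly-rec t) (endPoly-rec t)
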